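{- Let $a$ be a positive integer and let $\sigma$ be a uniformly random permutation of $\{1,\ldots,2a+1\}$. Then for every integer $t$, $\Pr[D_{a,a}(\sigma)=t]\le\frac1{2a+1}$.
   Context: For positive integers $a,b$ with $a+b<n$ and a permutation $\sigma$ of $\{1,\ldots,n\}$, define $D_{a,b}(\sigma)=\sum_{i=1}^{a}\sigma(i)-\sum_{i=a+1}^{a+b}\sigma(i)$. -}

module Defs where

open import Data.Nat using (ℕ; zero; suc)
open import Data.Fin using (Fin; toℕ)
open import Data.Fin.Properties using (_≟_)
open import Data.Vec using (Vec; []; _∷_; toList)
open import Data.List using (List; allFin; [_]; map; concatMap; filter; take; drop; length)
open import Data.Nat.ListAction using (sum)
open import Data.List.Relation.Unary.Unique.Propositional using (Unique)
open import Data.List.Relation.Unary.Unique.DecPropositional using (unique?)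
open import Data.Integer as ℤ using (ℤ; +_)

open import Relation.Nullary using (Dec)

-- All functions {1..k} → {1..n}, as vectors (σ(i) is the (i-1)-th entry,
-- the value j ∈ Fin n standing for j+1 ∈ {1,…,n}).
allVecs : (k n : ℕ) → List (Vec (Fin n) k)
allVecs zero    n = [ [] ]
allVecs (suc k) n = concatMap (λ x → map (x ∷_) (allVecs k n)) (allFin n)

IsPerm : {n : ℕ} → Vec (Fin n) n → Set
IsPerm σ = Unique (toList σ)

isPerm? : {n : ℕ} → (σ : Vec (Fin n) n) → Dec (IsPerm σ)
isPerm? σ = unique? _≟_ (toList σ)

-- The list of all n! permutations of {1,…,n} (sample space, uniform measure).
perms : (n : ℕ) → List (Vec (Fin n) n)
perms n = filter isPerm? (allVecs n n)

values : {n : ℕ} → Vec (Fin n) n → List ℕ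
values σ = map (λ j → suc (toℕ j)) (toList σ)

D : {n : ℕ} → (a b : ℕ) → Vec (Fin n) n → ℤ
D a b σ = (+ sum (take a (values σ))) ℤ.- (+ sum (take b (drop a (values σ))))

countD : (n a b : ℕ) → ℤ → ℕ
countD n a b t = length (filter (λ σ → D a b σ ℤ.≟ t) (perms n))

module Submission where

-- Let n = a + b + 1 and let ρ be σ with the values σ(n) and n exchanged, so that ρ(n) = n.
-- On the positions 1, …, n − 1 the only change is that the entry n of σ becomes σ(n); hence
-- D(σ) − D(ρ) is n − σ(n) or −(n − σ(n)) according to the block holding n (and 0 when
-- σ(n) = n), that is, |D(σ) − D(ρ)| = n − σ(n). So ρ and D(σ) determine σ(n), hence σ, and
-- replacing the final entry n of ρ by an arbitrary value c gives an injection from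
-- {σ : D(σ) = t} × {1, …, n} into the permutations: n · #{σ : D(σ) = t} ≤ n!.

open import Defs
open import Data.Nat as ℕ using (ℕ; zero; suc; _+_; _*_; _∸_; _≤_; _≰_; z≤n; s≤s)
open import Data.Nat.Properties as ℕ
  using (≤-trans; ≤-reflexive; +-suc; +-comm; +-assoc; n∸n≡0; ∸-cancelˡ-≡; suc-injective; <-irrefl)
open import Data.Integer as ℤ using (ℤ; +_; _-_; _⊖_; ∣_∣)
open import Data.Integer.Properties using (m-n≡m⊖n; +-cancelˡ-⊖; ∣⊖∣-≤; ∣m⊖n∣≡∣n⊖m∣; +-inverseʳ)
open import Data.Fin using (Fin; toℕ; fromℕ)
open import Data.Fin.Properties using (_≟_; toℕ-fromℕ; toℕ-injective; toℕ≤pred[n])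
open import Data.Fin.Permutation.Components using (transpose; transpose-inverse)
open import Data.Vec as Vec using (Vec; []; _∷_; toList; lookup)
open import Data.Vec.Properties
  using (toList-map; lookup-map; map-∘; map-cong; map-id; length-toList; ∷-injectiveˡ; ∷-injectiveʳ)
open import Data.List
  using (List; []; _∷_; _++_; [_]; map; take; drop; length; filter; allFin; cartesianProduct)
open import Data.List.Properties using (length-++; length-map; length-tabulate; map-++; map-id-local)
open import Data.Nat.ListAction using (sum)
open import Data.List.Membership.Propositional using (_∈_; _∉_)
open import Data.List.Membership.Propositional.Properties
open import Data.List.Relation.Unary.Any as Any using (here; there)
open import Data.List.Relation.Unary.All as All using (All; [])
open import Data.List.Relation.Unary.AllPairs as AllPairs using ([]; _∷_)
import Data.List.Relation.Unary.AllPairs.Properties as AllPairs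
open import Data.List.Relation.Unary.Unique.Propositional using (Unique)
import Data.List.Relation.Unary.Unique.Propositional.Properties as Unique
open import Data.List.Relation.Binary.Disjoint.Propositional using (Disjoint)
open import Data.Product using (∃₂; _×_; _,_; proj₁; proj₂)
open import Data.Sum as Sum using (_⊎_; inj₁; inj₂)
open import Function using (_∘_; id)
open import Relation.Binary.PropositionalEquality hiding ([_])
open import Relation.Nullary using (Dec; yes; no; contradiction)
open import Relation.Nullary.Decidable using (dec-true; dec-false)
open import Data.Integer.Solver using (module +-*-Solver)
open +-*-Solver using (solve; _:-_; _:=_)

private
  variable
    A B : Set
    xs ys : List A

Unique-⊆⇒length≤ : Unique xs → (∀ {z} → z ∈ xs → z ∈ ys) → length xs ≤ length ys
Unique-⊆⇒length≤ {xs = []} _ _ = z≤n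
Unique-⊆⇒length≤ {xs = x ∷ xs} {ys} (x∉xs ∷ xs!) xs⊆ys with ∈-∃++ (xs⊆ys (here refl))
... | zs , ws , refl = begin
  suc (length xs)             ≤⟨ s≤s (Unique-⊆⇒length≤ xs! xs⊆zs++ws) ⟩
  suc (length (zs ++ ws))     ≡⟨ cong suc (length-++ zs) ⟩
  suc (length zs + length ws) ≡⟨ +-suc (length zs) (length ws) ⟨
  length zs + length (x ∷ ws) ≡⟨ length-++ zs ⟨
  length (zs ++ x ∷ ws)       ∎
  where
  open ℕ.≤-Reasoning
  xs⊆zs++ws : ∀ {z} → z ∈ xs → z ∈ zs ++ ws
  xs⊆zs++ws {z} z∈xs with ∈-++⁻ zs (xs⊆ys (there z∈xs))
  ... | inj₁ z∈zs         = ∈-++⁺ˡ z∈zs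
  ... | inj₂ (here z≡x)   = contradiction (sym z≡x) (All.lookup x∉xs z∈xs)
  ... | inj₂ (there z∈ws) = ∈-++⁺ʳ zs z∈ws

Unique-map⁺ : (h : A → B) → (∀ {x x′} → x ∈ xs → x′ ∈ xs → h x ≡ h x′ → x ≡ x′) →
              Unique xs → Unique (map h xs)
Unique-map⁺ {xs = []} h _ [] = []
Unique-map⁺ {xs = x ∷ xs} h h-inj (x∉xs ∷ xs!) =
  All.tabulate hx∉ ∷ Unique-map⁺ h (λ p q → h-inj (there p) (there q)) xs!
  where
  hx∉ : ∀ {z} → z ∈ map h xs → h x ≢ z
  hx∉ z∈ hx≡z with ∈-map⁻ h z∈
  ... | w , w∈xs , refl = All.lookup x∉xs w∈xs (h-inj (here refl) (there w∈xs) hx≡z)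

length≤-injectiveOn : (h : A → B) → Unique xs → (∀ {x} → x ∈ xs → h x ∈ ys) →
                      (∀ {x x′} → x ∈ xs → x′ ∈ xs → h x ≡ h x′ → x ≡ x′) →
                      length xs ≤ length ys
length≤-injectiveOn {xs = xs} {ys = ys} h xs! h∈ys h-inj = begin
  length xs         ≡⟨ length-map h xs ⟨
  length (map h xs) ≤⟨ Unique-⊆⇒length≤ (Unique-map⁺ h h-inj xs!) image⊆ys ⟩
  length ys         ∎
  where
  open ℕ.≤-Reasoning
  image⊆ys : ∀ {z} → z ∈ map h xs → z ∈ ys
  image⊆ys z∈ with ∈-map⁻ h z∈
  ... | w , w∈xs , refl = h∈ys w∈xs

length-cartesianProduct : (xs : List A) (ys : List B) →
                          length (cartesianProduct xs ys) ≡ length xs * length ys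
length-cartesianProduct []       ys = refl
length-cartesianProduct (x ∷ xs) ys = begin
  length (map (x ,_) ys ++ cartesianProduct xs ys)
    ≡⟨ length-++ (map (x ,_) ys) ⟩
  length (map (x ,_) ys) + length (cartesianProduct xs ys)
    ≡⟨ cong₂ _+_ (length-map (x ,_) ys) (length-cartesianProduct xs ys) ⟩
  length ys + length xs * length ys ∎
  where open ≡-Reasoning

Unique-++⁻ : Unique (xs ++ ys) → Unique xs × Unique ys × Disjoint xs ys
Unique-++⁻ {xs = []}     ys! = [] , ys! , λ ()
Unique-++⁻ {xs = x ∷ xs} (x∉ ∷ xs++ys!) with Unique-++⁻ {xs = xs} xs++ys!
... | xs! , ys! , disjoint =
  All.tabulate (All.lookup x∉ ∘ ∈-++⁺ˡ) ∷ xs! , ys! ,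
  λ { (here refl , x∈ys) → All.lookup x∉ (∈-++⁺ʳ xs x∈ys) refl
    ; (there z∈xs , z∈ys) → disjoint (z∈xs , z∈ys) }

sum-map-update : (g : A → ℕ) (f : A → A) {u : A} {l : List A} → Unique l → u ∈ l →
                 (∀ {k} → k ∈ l → k ≢ u → f k ≡ k) →
                 sum (map g (map f l)) + g u ≡ sum (map g l) + g (f u)
sum-map-update g f {u} {u ∷ l} (u∉l ∷ _) (here refl) f-fix = begin
  g (f u) + sum (map g (map f l)) + g u
    ≡⟨ cong (λ l′ → g (f u) + sum (map g l′) + g u) (map-id-local f-fixes-l) ⟩
  g (f u) + sum (map g l) + g u
    ≡⟨ +-comm (g (f u) + _) (g u) ⟩
  g u + (g (f u) + sum (map g l))
    ≡⟨ cong (_+_ (g u)) (+-comm (g (f u)) _) ⟩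
  g u + (sum (map g l) + g (f u))
    ≡⟨ +-assoc (g u) _ (g (f u)) ⟨
  g u + sum (map g l) + g (f u) ∎
  where
  open ≡-Reasoning
  f-fixes-l : All (λ k → f k ≡ k) l
  f-fixes-l = All.tabulate λ k∈l → f-fix (there k∈l) (λ { refl → All.lookup u∉l k∈l refl })
sum-map-update g f {u} {k ∷ l} (k∉l ∷ l!) (there u∈l) f-fix = begin
  g (f k) + sum (map g (map f l)) + g u
    ≡⟨ cong (λ k′ → g k′ + _ + g u) (f-fix (here refl) (All.lookup k∉l u∈l)) ⟩
  g k + sum (map g (map f l)) + g u
    ≡⟨ +-assoc (g k) _ (g u) ⟩
  g k + (sum (map g (map f l)) + g u)
    ≡⟨ cong (_+_ (g k)) (sum-map-update g f l! u∈l (f-fix ∘ there)) ⟩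
  g k + (sum (map g l) + g (f u))
    ≡⟨ +-assoc (g k) _ (g (f u)) ⟨
  g k + sum (map g l) + g (f u) ∎
  where open ≡-Reasoning

map-++-++ : ∀ (f : A → B) l₁ l₂ l₃ → map f (l₁ ++ l₂ ++ l₃) ≡ map f l₁ ++ map f l₂ ++ map f l₃
map-++-++ f l₁ l₂ l₃ = trans (map-++ f l₁ _) (cong (map f l₁ ++_) (map-++ f l₂ l₃))

take-++-length : ∀ {k} (p q : List A) → length p ≡ k → take k (p ++ q) ≡ p
take-++-length []      q refl = refl
take-++-length (x ∷ p) q refl = cong (x ∷_) (take-++-length p q refl)

drop-++-length : ∀ {k} (p q : List A) → length p ≡ k → drop k (p ++ q) ≡ q
drop-++-length []      q refl = refl
drop-++-length (x ∷ p) q refl = drop-++-length p q refl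

toList-blocks : ∀ a b (v : Vec A (suc (a + b))) → ∃₂ λ l₁ l₂ → length l₁ ≡ a × length l₂ ≡ b ×
                toList v ≡ l₁ ++ l₂ ++ [ lookup v (fromℕ (a + b)) ]
toList-blocks zero    zero    (x ∷ []) = [] , [] , refl , refl , refl
toList-blocks zero    (suc b) (x ∷ v) with toList-blocks zero b v
... | [] , l₂ , _ , len₂ , eq = [] , x ∷ l₂ , refl , cong suc len₂ , cong (x ∷_) eq
toList-blocks (suc a) b       (x ∷ v) with toList-blocks a b v
... | l₁ , l₂ , len₁ , len₂ , eq = x ∷ l₁ , l₂ , cong suc len₁ , len₂ , cong (x ∷_) eq

∣⊖∣-shift : ∀ {p q k m} → p + m ≡ q + k → k ≤ m → ∣ p ⊖ q ∣ ≡ m ∸ k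
∣⊖∣-shift {p} {q} {k} {m} eq k≤m = begin
  ∣ p ⊖ q ∣             ≡⟨ cong ∣_∣ (+-cancelˡ-⊖ m p q) ⟨
  ∣ (m + p) ⊖ (m + q) ∣ ≡⟨ cong₂ (λ i j → ∣ i ⊖ j ∣) (trans (+-comm m p) eq) (+-comm m q) ⟩
  ∣ (q + k) ⊖ (q + m) ∣ ≡⟨ cong ∣_∣ (+-cancelˡ-⊖ q k m) ⟩
  ∣ k ⊖ m ∣             ≡⟨ ∣⊖∣-≤ k≤m ⟩
  m ∸ k                 ∎
  where open ≡-Reasoning

Unique∧length≡n⇒∈ : ∀ {n} {l : List (Fin n)} → Unique l → length l ≡ n → ∀ z → z ∈ l
Unique∧length≡n⇒∈ {n} {l} l! len z with z ∈? l
  where open import Data.List.Membership.DecPropositional (_≟_ {n}) using (_∈?_)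
... | yes z∈l = z∈l
... | no  z∉l = contradiction (Unique-⊆⇒length≤ z∷l! (λ {w} _ → ∈-allFin w)) too-long
  where
  z∷l! : Unique (z ∷ l)
  z∷l! = All.tabulate (λ w∈l z≡w → z∉l (subst (_∈ l) (sym z≡w) w∈l)) ∷ l!
  too-long : suc (length l) ≰ length (allFin n)
  too-long le = <-irrefl refl (≤-trans le (≤-reflexive (trans (length-tabulate id) (sym len))))

module _ {n : ℕ} where

  transpose-matchˡ : ∀ (i j : Fin n) → transpose i j i ≡ j
  transpose-matchˡ i j rewrite dec-true (i ≟ i) refl = refl

  transpose-matchʳ : ∀ (i j : Fin n) → transpose i j j ≡ i
  transpose-matchʳ i j with j ≟ i
  ... | yes refl = refl
  ... | no  _    rewrite dec-true (j ≟ j) refl = refl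

  transpose-fix : ∀ {i j k : Fin n} → k ≢ i → k ≢ j → transpose i j k ≡ k
  transpose-fix {i} {j} {k} k≢i k≢j rewrite dec-false (k ≟ i) k≢i | dec-false (k ≟ j) k≢j = refl

  map-transpose-fix : ∀ {i j : Fin n} {l} → i ∉ l → j ∉ l → map (transpose i j) l ≡ l
  map-transpose-fix i∉l j∉l =
    map-id-local (All.tabulate λ k∈l → transpose-fix (λ { refl → i∉l k∈l }) (λ { refl → j∉l k∈l }))

  map-transpose-inverse : ∀ {k} (i j : Fin n) (v : Vec (Fin n) k) →
                          Vec.map (transpose i j) (Vec.map (transpose j i) v) ≡ v
  map-transpose-inverse i j v = begin
    Vec.map (transpose i j) (Vec.map (transpose j i) v) ≡⟨ map-∘ (transpose i j) (transpose j i) v ⟨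
    Vec.map (transpose i j ∘ transpose j i) v           ≡⟨ map-cong (λ _ → transpose-inverse i j) v ⟩
    Vec.map id v                                        ≡⟨ map-id v ⟩
    v                                                   ∎
    where open ≡-Reasoning

  transpose-injective : ∀ (i j : Fin n) {k l} → transpose i j k ≡ transpose i j l → k ≡ l
  transpose-injective i j {k} {l} eq = begin
    k                               ≡⟨ transpose-inverse j i ⟨
    transpose j i (transpose i j k) ≡⟨ cong (transpose j i) eq ⟩
    transpose j i (transpose i j l) ≡⟨ transpose-inverse j i ⟩
    l                               ∎
    where open ≡-Reasoning

  IsPerm-map-transpose : ∀ (i j : Fin n) {σ : Vec (Fin n) n} →
                         IsPerm σ → IsPerm (Vec.map (transpose i j) σ)
  IsPerm-map-transpose i j {σ} σ! =
    subst Unique (sym (toList-map (transpose i j) σ)) (Unique.map⁺ (transpose-injective i j) σ!)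

∈-allVecs : ∀ {k n} (v : Vec (Fin n) k) → v ∈ allVecs k n
∈-allVecs []      = here refl
∈-allVecs {suc k} {n} (x ∷ v) =
  ∈-concatMap⁺ (λ y → map (y ∷_) (allVecs k n))
               (Any.map (λ { refl → ∈-map⁺ (x ∷_) (∈-allVecs v) }) (∈-allFin x))

allVecs-unique : ∀ k n → Unique (allVecs k n)
allVecs-unique zero    n = [] ∷ []
allVecs-unique (suc k) n =
  Unique.concat⁺ (All.tabulate λ {vs} vs∈ → let _ , _ , vs≡ = ∈-map⁻ prefixed vs∈ in
                   subst Unique (sym vs≡) (Unique.map⁺ ∷-injectiveʳ (allVecs-unique k n)))
                 (AllPairs.map⁺ (AllPairs.map prefixed-disjoint (Unique.allFin⁺ n)))
  where
  prefixed : Fin n → List (Vec (Fin n) (suc k))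
  prefixed x = map (x ∷_) (allVecs k n)
  prefixed-disjoint : ∀ {x y} → x ≢ y → Disjoint (prefixed x) (prefixed y)
  prefixed-disjoint x≢y (v∈x , v∈y) with ∈-map⁻ (_ ∷_) v∈x | ∈-map⁻ (_ ∷_) v∈y
  ... | _ , _ , refl | _ , _ , eq = x≢y (∷-injectiveˡ eq)

perms-unique : ∀ n → Unique (perms n)
perms-unique n = Unique.filter⁺ isPerm? (allVecs-unique n n)

∈-perms⁺ : ∀ {n} {σ : Vec (Fin n) n} → IsPerm σ → σ ∈ perms n
∈-perms⁺ σ! = ∈-filter⁺ isPerm? (∈-allVecs _) σ!

∈-perms⁻ : ∀ {n} {σ : Vec (Fin n) n} → σ ∈ perms n → IsPerm σ
∈-perms⁻ {n} σ∈ = proj₂ (∈-filter⁻ isPerm? {xs = allVecs n n} σ∈)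

module _ {n : ℕ} where

  value : Fin n → ℕ
  value j = suc (toℕ j)

  blockSum : List (Fin n) → ℕ
  blockSum l = sum (map value l)

  blockDiff : List (Fin n) → List (Fin n) → ℤ
  blockDiff l₁ l₂ = + blockSum l₁ - + blockSum l₂

  blockDiff-sameʳ : ∀ l₁ l₁′ l₂ → blockDiff l₁ l₂ - blockDiff l₁′ l₂ ≡ blockSum l₁ ⊖ blockSum l₁′
  blockDiff-sameʳ l₁ l₁′ l₂ =
    trans ([i-k]-[j-k]≡i-j (+ blockSum l₁) (+ blockSum l₁′) (+ blockSum l₂))
          (m-n≡m⊖n (blockSum l₁) (blockSum l₁′))
    where
    [i-k]-[j-k]≡i-j : ∀ i j k → (i - k) - (j - k) ≡ i - j
    [i-k]-[j-k]≡i-j = solve 3 (λ i j k → (i :- k) :- (j :- k) := i :- j) refl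

  blockDiff-sameˡ : ∀ l₁ l₂ l₂′ → blockDiff l₁ l₂ - blockDiff l₁ l₂′ ≡ blockSum l₂′ ⊖ blockSum l₂
  blockDiff-sameˡ l₁ l₂ l₂′ =
    trans ([k-i]-[k-j]≡j-i (+ blockSum l₂) (+ blockSum l₂′) (+ blockSum l₁))
          (m-n≡m⊖n (blockSum l₂′) (blockSum l₂))
    where
    [k-i]-[k-j]≡j-i : ∀ i j k → (k - i) - (k - j) ≡ j - i
    [k-i]-[k-j]≡j-i = solve 3 (λ i j k → (k :- i) :- (k :- j) := j :- i) refl

  blockSum-transpose : ∀ {x y : Fin n} {l} → Unique l → y ∈ l → x ∉ l →
                       blockSum (map (transpose x y) l) + value y ≡ blockSum l + value x
  blockSum-transpose {x} {y} {l} l! y∈l x∉l =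
    trans (sum-map-update value (transpose x y) l! y∈l
             (λ k∈l k≢y → transpose-fix (λ { refl → x∉l k∈l }) k≢y))
          (cong (λ z → blockSum l + value z) (transpose-matchʳ x y))

  ∣blockDiff-transpose∣ : ∀ {l₁ l₂ : List (Fin n)} {x y} →
    Unique (l₁ ++ l₂ ++ [ x ]) → y ∈ l₁ ++ l₂ ++ [ x ] → value x ≤ value y →
    ∣ blockDiff l₁ l₂ - blockDiff (map (transpose x y) l₁) (map (transpose x y) l₂) ∣
      ≡ value y ∸ value x
  ∣blockDiff-transpose∣ {l₁} {l₂} {x} {y} l! y∈ x≤y = by-position position
    where
    open ≡-Reasoning
    f : Fin n → Fin n
    f = transpose x y
    l₁! : Unique l₁
    l₁! = proj₁ (Unique-++⁻ l!)
    l₂x! : Unique (l₂ ++ [ x ])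
    l₂x! = proj₁ (proj₂ (Unique-++⁻ {xs = l₁} l!))
    l₂! : Unique l₂
    l₂! = proj₁ (Unique-++⁻ l₂x!)
    l₁#l₂x : Disjoint l₁ (l₂ ++ [ x ])
    l₁#l₂x = proj₂ (proj₂ (Unique-++⁻ l!))
    x∉l₁ : x ∉ l₁
    x∉l₁ x∈l₁ = l₁#l₂x (x∈l₁ , ∈-++⁺ʳ l₂ (here refl))
    x∉l₂ : x ∉ l₂
    x∉l₂ x∈l₂ = proj₂ (proj₂ (Unique-++⁻ {xs = l₂} l₂x!)) (x∈l₂ , here refl)
    position : y ∈ l₁ ⊎ y ∈ l₂ ⊎ y ≡ x
    position = Sum.map₂ (Sum.map₂ λ { (here y≡x) → y≡x ; (there ()) })
                        (Sum.map₂ (∈-++⁻ l₂) (∈-++⁻ l₁ y∈))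
    by-position : y ∈ l₁ ⊎ y ∈ l₂ ⊎ y ≡ x →
      ∣ blockDiff l₁ l₂ - blockDiff (map f l₁) (map f l₂) ∣ ≡ value y ∸ value x
    by-position (inj₁ y∈l₁) = begin
      ∣ blockDiff l₁ l₂ - blockDiff (map f l₁) (map f l₂) ∣
        ≡⟨ cong (λ l → ∣ blockDiff l₁ l₂ - blockDiff (map f l₁) l ∣) (map-transpose-fix x∉l₂ y∉l₂) ⟩
      ∣ blockDiff l₁ l₂ - blockDiff (map f l₁) l₂ ∣
        ≡⟨ cong ∣_∣ (blockDiff-sameʳ l₁ (map f l₁) l₂) ⟩
      ∣ blockSum l₁ ⊖ blockSum (map f l₁) ∣
        ≡⟨ ∣m⊖n∣≡∣n⊖m∣ (blockSum l₁) (blockSum (map f l₁)) ⟩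
      ∣ blockSum (map f l₁) ⊖ blockSum l₁ ∣
        ≡⟨ ∣⊖∣-shift (blockSum-transpose l₁! y∈l₁ x∉l₁) x≤y ⟩
      value y ∸ value x ∎
      where
      y∉l₂ : y ∉ l₂
      y∉l₂ y∈l₂ = l₁#l₂x (y∈l₁ , ∈-++⁺ˡ y∈l₂)
    by-position (inj₂ (inj₁ y∈l₂)) = begin
      ∣ blockDiff l₁ l₂ - blockDiff (map f l₁) (map f l₂) ∣
        ≡⟨ cong (λ l → ∣ blockDiff l₁ l₂ - blockDiff l (map f l₂) ∣) (map-transpose-fix x∉l₁ y∉l₁) ⟩
      ∣ blockDiff l₁ l₂ - blockDiff l₁ (map f l₂) ∣
        ≡⟨ cong ∣_∣ (blockDiff-sameˡ l₁ l₂ (map f l₂)) ⟩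
      ∣ blockSum (map f l₂) ⊖ blockSum l₂ ∣
        ≡⟨ ∣⊖∣-shift (blockSum-transpose l₂! y∈l₂ x∉l₂) x≤y ⟩
      value y ∸ value x ∎
      where
      y∉l₁ : y ∉ l₁
      y∉l₁ y∈l₁ = l₁#l₂x (y∈l₁ , ∈-++⁺ˡ y∈l₂)
    by-position (inj₂ (inj₂ refl)) = begin
      ∣ blockDiff l₁ l₂ - blockDiff (map f l₁) (map f l₂) ∣
        ≡⟨ cong₂ (λ l l′ → ∣ blockDiff l₁ l₂ - blockDiff l l′ ∣)
                 (map-transpose-fix x∉l₁ x∉l₁) (map-transpose-fix x∉l₂ x∉l₂) ⟩
      ∣ blockDiff l₁ l₂ - blockDiff l₁ l₂ ∣
        ≡⟨ cong ∣_∣ (+-inverseʳ (blockDiff l₁ l₂)) ⟩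
      0
        ≡⟨ n∸n≡0 (value x) ⟨
      value x ∸ value x ∎

D-blocks : ∀ {n a b} {v : Vec (Fin n) n} (l₁ l₂ : List (Fin n)) {r} →
           length l₁ ≡ a → length l₂ ≡ b → toList v ≡ l₁ ++ l₂ ++ r → D a b v ≡ blockDiff l₁ l₂
D-blocks {a = a} {b} {v} l₁ l₂ {r} len₁ len₂ eq =
  cong₂ (λ s₁ s₂ → + sum s₁ - + sum s₂) take-first take-second
  where
  len₁′ : length (map value l₁) ≡ a
  len₁′ = trans (length-map value l₁) len₁
  values≡ : values v ≡ map value l₁ ++ map value l₂ ++ map value r
  values≡ = trans (cong (map value) eq) (map-++-++ value l₁ l₂ r)
  take-first : take a (values v) ≡ map value l₁
  take-first = trans (cong (take a) values≡) (take-++-length (map value l₁) _ len₁′)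
  take-second : take b (drop a (values v)) ≡ map value l₂
  take-second = trans (cong (take b ∘ drop a) values≡)
    (trans (cong (take b) (drop-++-length (map value l₁) _ len₁′))
           (take-++-length (map value l₂) _ (trans (length-map value l₂) len₂)))

module _ (a b : ℕ) where

  private
    n : ℕ
    n = suc (a + b)

  -- Both the last position and the largest value n.
  top : Fin n
  top = fromℕ (a + b)

  value≤value-top : ∀ (j : Fin n) → value j ≤ value top
  value≤value-top j = s≤s (≤-trans (toℕ≤pred[n] j) (≤-reflexive (sym (toℕ-fromℕ (a + b)))))

  normalise : Vec (Fin n) n → Vec (Fin n) n
  normalise σ = Vec.map (transpose (lookup σ top) top) σ

  lookup-normalise : ∀ σ → lookup (normalise σ) top ≡ top
  lookup-normalise σ = trans (lookup-map top _ σ) (transpose-matchˡ (lookup σ top) top)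

  ∣D-normalise∣ : ∀ {σ} → IsPerm σ →
                  ∣ D a b σ - D a b (normalise σ) ∣ ≡ value top ∸ value (lookup σ top)
  ∣D-normalise∣ {σ} σ! with toList-blocks a b σ
  ... | l₁ , l₂ , len₁ , len₂ , eq = begin
    ∣ D a b σ - D a b (normalise σ) ∣
      ≡⟨ cong₂ (λ i j → ∣ i - j ∣) (D-blocks l₁ l₂ len₁ len₂ eq)
               (D-blocks (map f l₁) (map f l₂) len₁′ len₂′ eq′) ⟩
    ∣ blockDiff l₁ l₂ - blockDiff (map f l₁) (map f l₂) ∣
      ≡⟨ ∣blockDiff-transpose∣ {l₁ = l₁} {l₂} {x} {top} σ-blocks! top∈ (value≤value-top x) ⟩
    value top ∸ value x ∎
    where
    open ≡-Reasoning
    x : Fin n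
    x = lookup σ top
    f : Fin n → Fin n
    f = transpose x top
    len₁′ : length (map f l₁) ≡ a
    len₁′ = trans (length-map f l₁) len₁
    len₂′ : length (map f l₂) ≡ b
    len₂′ = trans (length-map f l₂) len₂
    eq′ : toList (normalise σ) ≡ map f l₁ ++ map f l₂ ++ [ f x ]
    eq′ = trans (toList-map f σ) (trans (cong (map f) eq) (map-++-++ f l₁ l₂ [ x ]))
    σ-blocks! : Unique (l₁ ++ l₂ ++ [ x ])
    σ-blocks! = subst Unique eq σ!
    top∈ : top ∈ l₁ ++ l₂ ++ [ x ]
    top∈ = subst (top ∈_) eq (Unique∧length≡n⇒∈ σ! (length-toList σ) top)

  normalise-injective : ∀ {σ τ} → IsPerm σ → IsPerm τ → D a b σ ≡ D a b τ →
                        normalise σ ≡ normalise τ → σ ≡ τ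
  normalise-injective {σ} {τ} σ! τ! Dσ≡Dτ ρσ≡ρτ = begin
    σ
      ≡⟨ map-transpose-inverse top x σ ⟨
    Vec.map (transpose top x) (normalise σ)
      ≡⟨ cong₂ (λ z ρ → Vec.map (transpose top z) ρ) x≡x′ ρσ≡ρτ ⟩
    Vec.map (transpose top x′) (normalise τ)
      ≡⟨ map-transpose-inverse top x′ τ ⟩
    τ ∎
    where
    open ≡-Reasoning
    x x′ : Fin n
    x = lookup σ top
    x′ = lookup τ top
    top∸x≡top∸x′ : value top ∸ value x ≡ value top ∸ value x′
    top∸x≡top∸x′ = trans (sym (∣D-normalise∣ σ!))
      (trans (cong₂ (λ i j → ∣ i - D a b j ∣) Dσ≡Dτ ρσ≡ρτ) (∣D-normalise∣ τ!))
    x≡x′ : x ≡ x′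
    x≡x′ = toℕ-injective (suc-injective
      (∸-cancelˡ-≡ (value≤value-top x) (value≤value-top x′) top∸x≡top∸x′))

  encode : Vec (Fin n) n × Fin n → Vec (Fin n) n
  encode (σ , c) = Vec.map (transpose c top) (normalise σ)

  lookup-encode : ∀ σ c → lookup (encode (σ , c)) top ≡ c
  lookup-encode σ c = trans (lookup-map top _ (normalise σ))
    (trans (cong (transpose c top) (lookup-normalise σ)) (transpose-matchʳ c top))

  encode-injective : ∀ {σ τ c d} → IsPerm σ → IsPerm τ → D a b σ ≡ D a b τ →
                     encode (σ , c) ≡ encode (τ , d) → (σ , c) ≡ (τ , d)
  encode-injective {σ} {τ} {c} {d} σ! τ! Dσ≡Dτ eq =
    cong₂ _,_ (normalise-injective σ! τ! Dσ≡Dτ ρσ≡ρτ) c≡d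
    where
    open ≡-Reasoning
    c≡d : c ≡ d
    c≡d = trans (sym (lookup-encode σ c)) (trans (cong (λ v → lookup v top) eq) (lookup-encode τ d))
    ρσ≡ρτ : normalise σ ≡ normalise τ
    ρσ≡ρτ = begin
      normalise σ
        ≡⟨ map-transpose-inverse top c (normalise σ) ⟨
      Vec.map (transpose top c) (encode (σ , c))
        ≡⟨ cong₂ (λ z v → Vec.map (transpose top z) v) c≡d eq ⟩
      Vec.map (transpose top d) (encode (τ , d))
        ≡⟨ map-transpose-inverse top d (normalise τ) ⟩
      normalise τ ∎

  IsPerm-encode : ∀ {σ} c → IsPerm σ → IsPerm (encode (σ , c))
  IsPerm-encode {σ} c σ! = IsPerm-map-transpose c top (IsPerm-map-transpose (lookup σ top) top σ!)

  countD*n≤length-perms : ∀ t → countD n a b t * n ≤ length (perms n)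
  countD*n≤length-perms t = begin
    countD n a b t * n           ≡⟨ cong (countD n a b t *_) (length-tabulate id) ⟨
    length L * length (allFin n) ≡⟨ length-cartesianProduct L (allFin n) ⟨
    length L×n                   ≤⟨ length≤-injectiveOn encode L×n! encode∈perms encode-injectiveOn ⟩
    length (perms n)             ∎
    where
    open ℕ.≤-Reasoning
    D≟t : ∀ σ → Dec (D a b σ ≡ t)
    D≟t σ = D a b σ ℤ.≟ t
    L : List (Vec (Fin n) n)
    L = filter D≟t (perms n)
    L×n : List (Vec (Fin n) n × Fin n)
    L×n = cartesianProduct L (allFin n)
    L×n! : Unique L×n
    L×n! = Unique.cartesianProduct⁺ (Unique.filter⁺ D≟t (perms-unique n)) (Unique.allFin⁺ n)
    fst∈L : ∀ {σ c} → (σ , c) ∈ L×n → σ ∈ perms n × D a b σ ≡ t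
    fst∈L p = ∈-filter⁻ D≟t {xs = perms n} (proj₁ (∈-cartesianProduct⁻ L (allFin n) p))
    IsPerm-fst : ∀ {σ c} → (σ , c) ∈ L×n → IsPerm σ
    IsPerm-fst p = ∈-perms⁻ (proj₁ (fst∈L p))
    encode-injectiveOn : ∀ {p q} → p ∈ L×n → q ∈ L×n → encode p ≡ encode q → p ≡ q
    encode-injectiveOn {_ , _} {_ , _} p q =
      encode-injective (IsPerm-fst p) (IsPerm-fst q) (trans (proj₂ (fst∈L p)) (sym (proj₂ (fst∈L q))))
    encode∈perms : ∀ {p} → p ∈ L×n → encode p ∈ perms n
    encode∈perms {_ , c} p = ∈-perms⁺ (IsPerm-encode c (IsPerm-fst p))

lemma5 : (a : ℕ) → 1 ≤ a → (t : ℤ) →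
         countD (suc (a + a)) a a t * suc (a + a) ≤ length (perms (suc (a + a)))
lemma5 a _ = countD*n≤length-perms a a
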